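{- Let $n\ge 1$ and let $\mathcal D,\mathcal D'\subseteq 2^{[n]}$ be such that $X$ and $Y$ are weakly separated for every $X\in\mathcal D$ and every $Y\in\mathcal D'$. If $\mathcal D\cup\mathcal D'$ is w-pure, then each of $\mathcal D$ and $\mathcal D'$ is w-pure.
   Context: $[n]=\{1,\dots,n\}$ with its usual order. For $A,B\subseteq[n]$, $A-B=\{a\in A: a\notin B\}$. Write $A\lessdot B$ if every element of $A-B$ is smaller than every element of $B-A$. Sets $A,B$ are strongly separated if $A=B$, or $A\lessdot B$, or $B\lessdot A$. Write $A\rhd B$ if $A-B\neq\emptyset$ and $B-A$ is a union of two nonempty sets $B',B''$ with every element of $B'$ smaller than every element of $A-B$, and every element of $A-B$ smaller than every element of $B''$. Sets $A,B$ are weakly separated if they are strongly separated, or $A\rhd B$ and $|A|\ge|B|$, or $B\rhd A$ and $|B|\ge|A|$. A collection is a w-collection if its members are pairwise weakly separated. A domain $\mathcal D\subseteq 2^{[n]}$ is w-pure if all inclusion-wise maximal w-collections contained in $\mathcal D$ have the same cardinality. -}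

module Defs where

open import Data.Nat using (ℕ; _≥_)
open import Data.Fin using (Fin; _<_)
open import Data.Fin.Subset using (Subset; _∈_; _∉_; ∣_∣; Nonempty)
open import Data.Product using (Σ; ∃; _×_; _,_)
open import Data.Sum using (_⊎_)
open import Data.List using (List; length)
open import Data.List.Membership.Propositional using () renaming (_∈_ to _∈L_)
open import Data.List.Relation.Unary.All using (All)
open import Data.List.Relation.Unary.Unique.Propositional using (Unique)
open import Relation.Nullary using (¬_)
open import Relation.Binary.PropositionalEquality using (_≡_)

_∈_-_ : ∀ {n} → Fin n → Subset n → Subset n → Set
x ∈ A - B = (x ∈ A) × (x ∉ B)

_⋖_ : ∀ {n} → Subset n → Subset n → Set
A ⋖ B = ∀ i j → i ∈ A - B → j ∈ B - A → i < j

StronglySeparated : ∀ {n} → Subset n → Subset n → Set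
StronglySeparated A B = (A ≡ B) ⊎ (A ⋖ B) ⊎ (B ⋖ A)

_▷_ : ∀ {n} → Subset n → Subset n → Set
_▷_ {n} A B =
  (∃ λ x → x ∈ A - B) ×
  Σ (Subset n) λ B' → Σ (Subset n) λ B'' →
    (∀ x → x ∈ B - A → (x ∈ B') ⊎ (x ∈ B'')) ×
    (∀ x → x ∈ B' → x ∈ B - A) ×
    (∀ x → x ∈ B'' → x ∈ B - A) ×
    Nonempty B' × Nonempty B'' ×
    (∀ i j → i ∈ B' → j ∈ A - B → i < j) ×
    (∀ i j → i ∈ A - B → j ∈ B'' → i < j)

WeaklySeparated : ∀ {n} → Subset n → Subset n → Set
WeaklySeparated A B =
  StronglySeparated A B
  ⊎ ((A ▷ B) × ∣ A ∣ ≥ ∣ B ∣)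
  ⊎ ((B ▷ A) × ∣ B ∣ ≥ ∣ A ∣)

Domain : ℕ → Set₁
Domain n = Subset n → Set

IsWCollection : ∀ {n} → List (Subset n) → Set
IsWCollection C = ∀ X Y → X ∈L C → Y ∈L C → WeaklySeparated X Y

WCollectionIn : ∀ {n} → Domain n → List (Subset n) → Set
WCollectionIn D C = Unique C × All D C × IsWCollection C

_⊆L_ : ∀ {n} → List (Subset n) → List (Subset n) → Set
C ⊆L C' = ∀ X → X ∈L C → X ∈L C'

MaximalWCollectionIn : ∀ {n} → Domain n → List (Subset n) → Set
MaximalWCollectionIn D C =
  WCollectionIn D C ×
  (∀ C' → WCollectionIn D C' → C ⊆L C' → C' ⊆L C)

WPure : ∀ {n} → Domain n → Set
WPure D = ∀ C C' → MaximalWCollectionIn D C → MaximalWCollectionIn D C' →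
          length C ≡ length C'

_∪D_ : ∀ {n} → Domain n → Domain n → Domain n
(D ∪D D') X = D X ⊎ D' X

-- Fix a maximal w-collection M of D' ∖ D (it exists since 2^[n] is finite). For every maximal
-- w-collection C of D, the collection C ∪ M is a maximal w-collection of D ∪ D': it is a
-- w-collection because D and D' are mutually weakly separated, and anything that could be added
-- to it would, according to whether it lies in D, extend C or M. Purity of D ∪ D' therefore gives
-- |C₁| + |M| = |C₂| + |M| for any two maximal w-collections of D, and the case of D' is symmetric.
module Submission where

open import Defs
open import Data.Nat using (ℕ; zero; suc; _≥_; _+_; _≟_)
open import Data.Nat.Properties using (+-cancelʳ-≡)
open import Data.Bool using (true; false) renaming (_≟_ to _≟ᵇ_)
open import Data.Vec using ([]; _∷_)
open import Data.Vec.Properties using (≡-dec)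
open import Data.Fin.Subset using (Subset)
open import Data.Product using (∃; _×_; _,_; proj₁; proj₂)
open import Data.Sum using (_⊎_; inj₁; inj₂; [_,_]; [_,_]′; swap)
open import Data.List using (List; []; _∷_; _++_; map; length)
open import Data.List.Properties using (length-++)
open import Data.List.Relation.Unary.Any using (here; there)
open import Data.List.Relation.Unary.All as All using (All; []; _∷_)
open import Data.List.Relation.Unary.All.Properties using (¬Any⇒All¬; ++⁺)
open import Data.List.Relation.Unary.AllPairs using ([]; _∷_)
open import Data.List.Relation.Binary.Disjoint.Propositional using (Disjoint)
import Data.List.Relation.Unary.Unique.Propositional.Properties as Unique
open import Data.List.Membership.Propositional using () renaming (_∈_ to _∈L_; _∉_ to _∉L_)
open import Data.List.Membership.Propositional.Properties using (∈-++⁺ˡ; ∈-++⁺ʳ; ∈-++⁻; ∈-map⁺)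
import Data.List.Membership.DecPropositional as DecMembership
open import Effect.Monad using (RawMonad)
open import Function using (_∘_; id)
open import Relation.Nullary using (¬_; Dec; yes; no; contradiction)
open import Relation.Nullary.Decidable using (decidable-stable; ¬¬-excluded-middle)
open import Relation.Nullary.Negation using (DoubleNegation; ¬¬-map; ¬¬-Monad)
open import Relation.Binary.PropositionalEquality using (_≡_; refl; sym; module ≡-Reasoning)
open ≡-Reasoning

private
  variable
    n : ℕ
    E F : Domain n
    X Y : Subset n
    C M : List (Subset n)

WeaklySeparated-sym : WeaklySeparated X Y → WeaklySeparated Y X
WeaklySeparated-sym (inj₁ (inj₁ X≡Y)) = inj₁ (inj₁ (sym X≡Y))
WeaklySeparated-sym (inj₁ (inj₂ X⋖Y⊎Y⋖X)) = inj₁ (inj₂ (swap X⋖Y⊎Y⋖X))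
WeaklySeparated-sym (inj₂ X▷Y⊎Y▷X) = inj₂ (swap X▷Y⊎Y▷X)

_∈L?_ : (X : Subset n) (C : List (Subset n)) → Dec (X ∈L C)
_∈L?_ = DecMembership._∈?_ (≡-dec _≟ᵇ_)

subsets : ∀ n → List (Subset n)
subsets zero = [] ∷ []
subsets (suc n) = map (true ∷_) (subsets n) ++ map (false ∷_) (subsets n)

∈-subsets : (X : Subset n) → X ∈L subsets n
∈-subsets [] = here refl
∈-subsets (true ∷ X) = ∈-++⁺ˡ (∈-map⁺ (true ∷_) (∈-subsets X))
∈-subsets {suc n} (false ∷ X) = ∈-++⁺ʳ (map (true ∷_) (subsets n)) (∈-map⁺ (false ∷_) (∈-subsets X))

_∖D_ : Domain n → Domain n → Domain n
(E ∖D F) X = E X × ¬ F X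

Addable : Domain n → List (Subset n) → Subset n → Set
Addable E M X = E X × (∀ Z → Z ∈L M → WeaklySeparated X Z)

addable-from-superset : ∀ {C'} → IsWCollection C' → M ⊆L C' → Y ∈L C' → E Y → Addable E M Y
addable-from-superset wsC' M⊆C' Y∈C' EY = EY , λ Z Z∈M → wsC' _ Z Y∈C' (M⊆C' Z Z∈M)

addable-∷⁻ : Addable E (X ∷ M) Y → Addable E M Y
addable-∷⁻ (EY , wsY) = EY , λ Z → wsY Z ∘ there

WCollectionIn-∷ : WCollectionIn E M → X ∉L M → Addable E M X → WCollectionIn E (X ∷ M)
WCollectionIn-∷ {M = M} (uniqueM , EM , wsM) X∉M (EX , wsX) =
  ¬Any⇒All¬ M X∉M ∷ uniqueM , EX ∷ EM , wsXM
  where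
  wsXM : IsWCollection _
  wsXM A B (here refl) (here refl) = inj₁ (inj₁ refl)
  wsXM A B (here refl) (there B∈M) = wsX B B∈M
  wsXM A B (there A∈M) (here refl) = WeaklySeparated-sym (wsX A A∈M)
  wsXM A B (there A∈M) (there B∈M) = wsM A B A∈M B∈M

IsWCollection-++ : IsWCollection C → IsWCollection M →
                   (∀ X Y → X ∈L C → Y ∈L M → WeaklySeparated X Y) → IsWCollection (C ++ M)
IsWCollection-++ {C = C} wsC wsM wsCM X Y X∈ Y∈ with ∈-++⁻ C X∈ | ∈-++⁻ C Y∈
... | inj₁ X∈C | inj₁ Y∈C = wsC X Y X∈C Y∈C
... | inj₂ X∈M | inj₂ Y∈M = wsM X Y X∈M Y∈M
... | inj₁ X∈C | inj₂ Y∈M = wsCM X Y X∈C Y∈M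
... | inj₂ X∈M | inj₁ Y∈C = WeaklySeparated-sym (wsCM Y X Y∈C X∈M)

maximal-closed : MaximalWCollectionIn E C → ∀ {C'} → IsWCollection C' → C ⊆L C' →
                 Y ∈L C' → E Y → Y ∈L C
maximal-closed {E = E} {C = C} {Y = Y} (wcC , maxC) wsC' C⊆C' Y∈C' EY with Y ∈L? C
... | yes Y∈C = Y∈C
... | no Y∉C = contradiction (maxC (Y ∷ C) wcYC (λ _ → there) Y (here refl)) Y∉C
  where
  wcYC : WCollectionIn E (Y ∷ C)
  wcYC = WCollectionIn-∷ wcC Y∉C (addable-from-superset {E = E} wsC' C⊆C' Y∈C' EY)

Saturated : Domain n → List (Subset n) → List (Subset n) → Set
Saturated E L M = All (λ X → X ∈L M ⊎ ¬ Addable E M X) L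

saturate-∷ : ∀ {L} → WCollectionIn E M → Saturated E L M → Dec (Addable E M X) →
             ∃ λ M′ → WCollectionIn E M′ × Saturated E (X ∷ L) M′
saturate-∷ {M = M} wcM satM (no ¬addX) = M , wcM , inj₂ ¬addX ∷ satM
saturate-∷ {E = E} {M = M} {X = X} wcM satM (yes addX) with X ∈L? M
... | yes X∈M = M , wcM , inj₁ X∈M ∷ satM
... | no X∉M = X ∷ M , WCollectionIn-∷ wcM X∉M addX ,
               inj₁ (here refl) ∷ All.map [ inj₁ ∘ there , (λ ¬add → inj₂ (¬add ∘ addable-∷⁻ {E = E})) ] satM

-- Membership in E is not decidable, so the greedy construction only yields its result up to double negation.
saturate : (E : Domain n) (L : List (Subset n)) →
           DoubleNegation (∃ λ M → WCollectionIn E M × Saturated E L M)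
saturate E [] k = k ([] , ([] , [] , λ _ _ ()) , [])
saturate E (X ∷ L) = do
  (M , wcM , satM) ← saturate E L
  addX? ← ¬¬-excluded-middle
  pure (saturate-∷ wcM satM addX?)
  where open RawMonad ¬¬-Monad

¬¬-maximal : (E : Domain n) → DoubleNegation (∃ (MaximalWCollectionIn E))
¬¬-maximal {n} E = ¬¬-map maximal (saturate E (subsets n))
  where
  maximal : ∃ (λ M → WCollectionIn E M × Saturated E (subsets n) M) → ∃ (MaximalWCollectionIn E)
  maximal (M , wcM , satM) = M , wcM , λ C' (_ , EC' , wsC') M⊆C' Y Y∈C' →
    [ id , contradiction (addable-from-superset {E = E} wsC' M⊆C' Y∈C' (All.lookup EC' Y∈C')) ]′
      (All.lookup satM (∈-subsets Y))

WCollectionIn-mono : (∀ {X} → E X → F X) → WCollectionIn E C → WCollectionIn F C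
WCollectionIn-mono E⊆F (uniqueC , EC , wsC) = uniqueC , All.map E⊆F EC , wsC

MaximalWCollectionIn-resp : (∀ {X} → E X → F X) → (∀ {X} → F X → E X) →
                            MaximalWCollectionIn E C → MaximalWCollectionIn F C
MaximalWCollectionIn-resp E⊆F F⊆E (wcC , maxC) =
  WCollectionIn-mono E⊆F wcC , λ C' → maxC C' ∘ WCollectionIn-mono F⊆E

WPure-resp : (∀ {X} → E X → F X) → (∀ {X} → F X → E X) → WPure E → WPure F
WPure-resp E⊆F F⊆E pureE C C' maxC maxC' =
  pureE C C' (MaximalWCollectionIn-resp F⊆E E⊆F maxC) (MaximalWCollectionIn-resp F⊆E E⊆F maxC')

module _ {D D' : Domain n} (separated : ∀ X Y → D X → D' Y → WeaklySeparated X Y) where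

  ++-maximal : MaximalWCollectionIn D C → MaximalWCollectionIn (D' ∖D D) M →
               MaximalWCollectionIn (D ∪D D') (C ++ M)
  ++-maximal {C = C} {M = M} maxC@((uniqueC , DC , wsC) , _) maxM@((uniqueM , D'M , wsM) , _) =
    (Unique.++⁺ uniqueC uniqueM disjoint , ++⁺ (All.map inj₁ DC) (All.map (inj₂ ∘ proj₁) D'M) , wsCM) ,
    maximal
    where
    disjoint : Disjoint C M
    disjoint (X∈C , X∈M) = proj₂ (All.lookup D'M X∈M) (All.lookup DC X∈C)
    wsCM : IsWCollection (C ++ M)
    wsCM = IsWCollection-++ wsC wsM λ X Y X∈C Y∈M →
      separated X Y (All.lookup DC X∈C) (proj₁ (All.lookup D'M Y∈M))
    maximal : ∀ C' → WCollectionIn (D ∪D D') C' → (C ++ M) ⊆L C' → C' ⊆L (C ++ M)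
    maximal C' (_ , DD'C' , wsC') CM⊆C' Y Y∈C' with Y ∈L? C
    ... | yes Y∈C = ∈-++⁺ˡ Y∈C
    ... | no Y∉C = ∈-++⁺ʳ C (maximal-closed maxM wsC' (λ Z → CM⊆C' Z ∘ ∈-++⁺ʳ C) Y∈C'
                             ([ (λ DY → contradiction (inC DY) Y∉C) , (λ D'Y → D'Y , Y∉C ∘ inC) ]
                                (All.lookup DD'C' Y∈C')))
      where
      inC : D Y → Y ∈L C
      inC = maximal-closed maxC wsC' (λ Z → CM⊆C' Z ∘ ∈-++⁺ˡ) Y∈C'

  WPure-∪ˡ : WPure (D ∪D D') → WPure D
  WPure-∪ˡ pure C₁ C₂ maxC₁ maxC₂ =
    decidable-stable (length C₁ ≟ length C₂) (¬¬-map padded-lengths (¬¬-maximal (D' ∖D D)))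
    where
    padded-lengths : ∃ (MaximalWCollectionIn (D' ∖D D)) → length C₁ ≡ length C₂
    padded-lengths (M , maxM) = +-cancelʳ-≡ (length M) (length C₁) (length C₂) (begin
      length C₁ + length M   ≡⟨ length-++ C₁ ⟨
      length (C₁ ++ M)       ≡⟨ pure (C₁ ++ M) (C₂ ++ M) (++-maximal maxC₁ maxM) (++-maximal maxC₂ maxM) ⟩
      length (C₂ ++ M)       ≡⟨ length-++ C₂ ⟩
      length C₂ + length M   ∎)

proposition1p2 : (n : ℕ) → n ≥ 1 → (D D' : Domain n) →
    (∀ X Y → D X → D' Y → WeaklySeparated X Y) →
    WPure (D ∪D D') → WPure D × WPure D'
proposition1p2 n _ D D' separated pure =
  WPure-∪ˡ separated pure ,
  WPure-∪ˡ (λ X Y D'X DY → WeaklySeparated-sym (separated Y X DY D'X)) (WPure-resp swap swap pure)
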